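{- There is an algorithm which, given a polynomial $D(x_1,\ldots,x_p) \in \mathbb{Z}[x_1,\ldots,x_p]$ with $\deg(D,x_i) \geqslant 1$ for each $i \in \{1,\ldots,p\}$, computes a positive integer $n>p$ and a system $\mathcal{T} \subseteq E_n$ satisfying the following two conditions. Condition 1: for all positive integers $\tilde{x}_1,\ldots,\tilde{x}_p$, \[ D(\tilde{x}_1,\ldots,\tilde{x}_p)=0 \iff \exists\, \tilde{x}_{p+1},\ldots,\tilde{x}_n \in \mathbb{N}\setminus\{0\} \text{ such that } (\tilde{x}_1,\ldots,\tilde{x}_n) \text{ solves } \mathcal{T}. \] Condition 2: if positive integers $\tilde{x}_1,\ldots,\tilde{x}_p$ satisfy $D(\tilde{x}_1,\ldots,\tilde{x}_p)=0$, then there exists a unique tuple $(\tilde{x}_{p+1},\ldots,\tilde{x}_n) \in (\mathbb{N}\setminus\{0\})^{n-p}$ such that $(\tilde{x}_1,\ldots,\tilde{x}_p,\tilde{x}_{p+1},\ldots,\tilde{x}_n)$ solves $\mathcal{T}$. Consequently, the equation $D(x_1,\ldots,x_p)=0$ and the system $\mathcal{T}$ have the same number of solutions in positive integers.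
   Context: For a positive integer $n$, let $E_n=\{x_i \cdot x_j=x_k,\ x_i+1=x_k:\ i,j,k \in \{1,\ldots,n\}\}$, a set of equations in the variables $x_1,\ldots,x_n$. $\mathbb{N}$ denotes the set of non-negative integers. -}

module Defs where

open import Data.Nat as ℕ using (ℕ; _<_; _≤_)
open import Data.Integer as ℤ using (ℤ)
open import Data.Fin using (Fin)
open import Data.Vec using (Vec; lookup)
open import Data.Vec.Properties using (≡-dec)
open import Data.List using (List; []; _∷_)
open import Data.Product using (_×_; _,_)
open import Relation.Nullary using (yes; no)
open import Relation.Binary.PropositionalEquality using (_≡_)
import Data.Vec.Functional as VF

-- A polynomial in ℤ[x_1,…,x_p], given as a finite list of terms
-- (coefficient, exponent vector).  Repeated exponent vectors are allowed;
-- the actual coefficient of a monomial is the sum over all such terms.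
Poly : ℕ → Set
Poly p = List (ℤ × Vec ℕ p)

monoEval : ∀ {p} → Vec ℕ p → (Fin p → ℕ) → ℤ
monoEval {ℕ.zero}  _ _ = ℤ.+ 1
monoEval {ℕ.suc p} α x =
  ℤ.+ (x Fin.zero ℕ.^ lookup α Fin.zero) ℤ.* monoEval {p} (Data.Vec.tail α) (λ i → x (Fin.suc i))
  where import Data.Fin as Fin

eval : ∀ {p} → Poly p → (Fin p → ℕ) → ℤ
eval []            x = ℤ.+ 0
eval ((c , α) ∷ D) x = c ℤ.* monoEval α x ℤ.+ eval D x

coeff : ∀ {p} → Poly p → Vec ℕ p → ℤ
coeff []             α = ℤ.+ 0
coeff ((c , β) ∷ D)  α with ≡-dec ℕ._≟_ β α
... | yes _ = c ℤ.+ coeff D α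
... | no  _ = coeff D α

DegGe1 : ∀ {p} → Poly p → Fin p → Set
DegGe1 D i = Data.Product.∃ λ α → (1 ≤ lookup α i) × (coeff D α ≡ ℤ.+ 0 → Data.Empty.⊥)
  where import Data.Product; import Data.Empty

data Eqn (n : ℕ) : Set where
  mulEq : Fin n → Fin n → Fin n → Eqn n
  sucEq : Fin n → Fin n → Eqn n

System : ℕ → Set
System n = List (Eqn n)

HoldsEqn : ∀ {n} → (Fin n → ℕ) → Eqn n → Set
HoldsEqn x (mulEq i j k) = x i ℕ.* x j ≡ x k
HoldsEqn x (sucEq i k)   = x i ℕ.+ 1 ≡ x k

Solves : ∀ {n} → (Fin n → ℕ) → System n → Set
Solves x []      = Data.Unit.⊤ where import Data.Unit
Solves x (e ∷ T) = HoldsEqn x e × Solves x T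

Positive : ∀ {n} → (Fin n → ℕ) → Set
Positive {n} x = (i : Fin n) → 1 ≤ x i

_⊕_ : ∀ {p m} → (Fin p → ℕ) → (Fin m → ℕ) → (Fin (p ℕ.+ m) → ℕ)
x ⊕ y = x VF.++ y

{-# OPTIONS --safe #-}
-- Write D = P − N, where P and N are built from 1 and the variables by +, · and
-- successor, so that on positive arguments every subterm of P and N is positive.
-- Every node of P and N gets an auxiliary variable: a ·- or successor-node is one
-- equation of E_n, and a sum Z = A + B is expressed by
--   (A Z + 1) (B Z + 1) = Z² (A B + 1) + 1,
-- which for positive Z says (A + B) Z = Z², i.e. Z = A + B.  A variable with
-- t · t = t stands for the constant 1, and two successor equations with a common
-- right-hand side say P = N.  Solving the system over positive integers forces every
-- auxiliary variable to be the value of its subterm, which gives existence and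
-- uniqueness of the extension at once.
module Submission where

open import Defs
open import Data.Nat using (ℕ; _+_; _≤_)
open import Data.Integer using (ℤ)
open import Data.Fin using (Fin)
open import Data.Product using (Σ; ∃; _×_)
open import Function.Bundles using (_⇔_)
open import Relation.Binary.PropositionalEquality using (_≡_)

open import Data.Nat using (zero; suc; _*_; _^_; _<_; _<?_; s≤s; z≤n)
import Data.Nat.Properties as ℕP
import Data.Nat.Tactic.RingSolver as ℕSolver
import Data.Integer as Z
import Data.Integer.Properties as ZP
import Data.Integer.Tactic.RingSolver as ZSolver
open import Data.Fin using (toℕ; fromℕ<; _↑ˡ_; _↑ʳ_; splitAt)
import Data.Fin.Properties as FinP
open import Data.Vec using (Vec; _∷_; [])
import Data.Vec.Functional.Properties as VecFunP
open import Data.List using (List; []; _∷_; _++_; length)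
open import Data.List.Properties using (length-++)
open import Data.List.Relation.Unary.All using (All; []; _∷_)
open import Data.List.Relation.Unary.All.Properties using (++⁺)
open import Data.Product using (_,_; proj₁; proj₂)
open import Data.Sum using (inj₁; inj₂)
open import Data.Unit using (⊤; tt)
open import Data.Empty using (⊥-elim)
open import Function using (_∘_; id)
open import Function.Bundles using (mk⇔; Equivalence)
open import Relation.Nullary using (yes; no)
open import Relation.Binary.PropositionalEquality using (refl; sym; trans; cong; cong₂; subst; module ≡-Reasoning)

data Expr (p : ℕ) : Set where
  var      : Fin p → Expr p
  one      : Expr p
  mul add  : Expr p → Expr p → Expr p
  succ     : Expr p → Expr p

⟦_⟧ : ∀ {p} → Expr p → (Fin p → ℕ) → ℕ
⟦ var i ⟧   x = x i
⟦ one ⟧     x = 1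
⟦ mul a b ⟧ x = ⟦ a ⟧ x * ⟦ b ⟧ x
⟦ add a b ⟧ x = ⟦ a ⟧ x + ⟦ b ⟧ x
⟦ succ a ⟧  x = ⟦ a ⟧ x + 1

1≤n+1 : ∀ n → 1 ≤ n + 1
1≤n+1 n = ℕP.m≤n+m 1 n

1≤m*n : ∀ {m n} → 1 ≤ m → 1 ≤ n → 1 ≤ m * n
1≤m*n = ℕP.*-mono-≤

⟦⟧-positive : ∀ {p} (e : Expr p) {x} → Positive x → 1 ≤ ⟦ e ⟧ x
⟦⟧-positive (var i)   x⁺ = x⁺ i
⟦⟧-positive one       x⁺ = s≤s z≤n
⟦⟧-positive (mul a b) x⁺ = 1≤m*n (⟦⟧-positive a x⁺) (⟦⟧-positive b x⁺)
⟦⟧-positive (add a b) {x} x⁺ = ℕP.≤-trans (⟦⟧-positive a x⁺) (ℕP.m≤m+n _ (⟦ b ⟧ x))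
⟦⟧-positive (succ a) {x} x⁺ = 1≤n+1 (⟦ a ⟧ x)

-- Polynomials as differences of expressions

numeral : ∀ {p} → ℕ → Expr p
numeral zero    = one
numeral (suc k) = succ (numeral k)

⟦numeral⟧ : ∀ {p} k (x : Fin p → ℕ) → ⟦ numeral k ⟧ x ≡ suc k
⟦numeral⟧ zero    x = refl
⟦numeral⟧ (suc k) x = trans (cong (_+ 1) (⟦numeral⟧ k x)) (ℕP.+-comm (suc k) 1)

pow : ∀ {p} → Expr p → ℕ → Expr p
pow e zero    = one
pow e (suc k) = mul e (pow e k)

⟦pow⟧ : ∀ {p} (e : Expr p) k x → ⟦ pow e k ⟧ x ≡ ⟦ e ⟧ x ^ k
⟦pow⟧ e zero    x = refl
⟦pow⟧ e (suc k) x = cong (⟦ e ⟧ x *_) (⟦pow⟧ e k x)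

monomial : ∀ {p q} → (Fin p → Fin q) → Vec ℕ p → Expr q
monomial σ []      = one
monomial σ (k ∷ α) = mul (pow (var (σ zero)) k) (monomial (σ ∘ suc) α)
  where open Data.Fin using (zero; suc)

monoEval-⟦monomial⟧ : ∀ {p q} (σ : Fin p → Fin q) α x → monoEval α (x ∘ σ) ≡ Z.+ ⟦ monomial σ α ⟧ x
monoEval-⟦monomial⟧ σ []      x = refl
monoEval-⟦monomial⟧ σ (k ∷ α) x = begin
  Z.+ (x (σ zero) ^ k) Z.* monoEval α (x ∘ σ ∘ suc)   ≡⟨ cong (Z.+ (x (σ zero) ^ k) Z.*_) (monoEval-⟦monomial⟧ (σ ∘ suc) α x) ⟩
  Z.+ (x (σ zero) ^ k) Z.* Z.+ ⟦ monomial (σ ∘ suc) α ⟧ x ≡⟨ ZP.pos-* (x (σ zero) ^ k) _ ⟨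
  Z.+ (x (σ zero) ^ k * ⟦ monomial (σ ∘ suc) α ⟧ x)     ≡⟨ cong (λ t → Z.+ (t * _)) (⟦pow⟧ (var (σ zero)) k x) ⟨
  Z.+ ⟦ monomial σ (k ∷ α) ⟧ x                          ∎
  where open ≡-Reasoning
        open Data.Fin using (zero; suc)

posPart negPart : ℤ → ℕ
posPart (Z.+ k)    = k
posPart Z.-[1+ k ] = 0
negPart (Z.+ k)    = 0
negPart Z.-[1+ k ] = suc k

posPart-negPart : ∀ c → Z.+ posPart c Z.- Z.+ negPart c ≡ c
posPart-negPart (Z.+ k)    = ZP.+-identityʳ (Z.+ k)
posPart-negPart Z.-[1+ k ] = refl

-- A term c x^α contributes (c⁺ + 1) x^α to posExpr and (c⁻ + 1) x^α to negExpr,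
-- so that both sides stay positive.
posExpr negExpr : ∀ {p} → Poly p → Expr p
posExpr []            = one
posExpr ((c , α) ∷ D) = add (mul (numeral (posPart c)) (monomial id α)) (posExpr D)
negExpr []            = one
negExpr ((c , α) ∷ D) = add (mul (numeral (negPart c)) (monomial id α)) (negExpr D)

pos-*-+ : ∀ a b c → Z.+ (a * b + c) ≡ Z.+ a Z.* Z.+ b Z.+ Z.+ c
pos-*-+ a b c = trans (ZP.pos-+ (a * b) c) (cong (Z._+ Z.+ c) (ZP.pos-* a b))

numeral-term : ∀ {p} k M P {x : Fin p → ℕ} →
  (Z.+ k Z.+ Z.1ℤ) Z.* Z.+ M Z.+ Z.+ P ≡ Z.+ (⟦ numeral k ⟧ x * M + P)
numeral-term k M P {x} = begin
  (Z.+ k Z.+ Z.1ℤ) Z.* Z.+ M Z.+ Z.+ P  ≡⟨ cong (λ t → t Z.* Z.+ M Z.+ Z.+ P) (ZP.+-comm (Z.+ k) Z.1ℤ) ⟩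
  Z.+ suc k Z.* Z.+ M Z.+ Z.+ P          ≡⟨ pos-*-+ (suc k) M P ⟨
  Z.+ (suc k * M + P)                    ≡⟨ cong (λ t → Z.+ (t * M + P)) (⟦numeral⟧ k x) ⟨
  Z.+ (⟦ numeral k ⟧ x * M + P)          ∎
  where open ≡-Reasoning

shifted-difference : ∀ (a b m P N : ℤ) →
  (a Z.+ Z.1ℤ) Z.* m Z.+ P Z.- ((b Z.+ Z.1ℤ) Z.* m Z.+ N) ≡ (a Z.- b) Z.* m Z.+ (P Z.- N)
shifted-difference = ZSolver.solve-∀

eval-difference : ∀ {p} (D : Poly p) x → eval D x ≡ Z.+ ⟦ posExpr D ⟧ x Z.- Z.+ ⟦ negExpr D ⟧ x
eval-difference []            x = refl
eval-difference ((c , α) ∷ D) x = begin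
  c Z.* monoEval α x Z.+ eval D x                          ≡⟨ cong₂ (λ u v → u Z.* monoEval α x Z.+ v) (sym (posPart-negPart c)) (eval-difference D x) ⟩
  (Z.+ a Z.- Z.+ b) Z.* monoEval α x Z.+ (Z.+ P Z.- Z.+ N) ≡⟨ cong (λ t → (Z.+ a Z.- Z.+ b) Z.* t Z.+ (Z.+ P Z.- Z.+ N)) (monoEval-⟦monomial⟧ id α x) ⟩
  (Z.+ a Z.- Z.+ b) Z.* Z.+ M Z.+ (Z.+ P Z.- Z.+ N)        ≡⟨ shifted-difference (Z.+ a) (Z.+ b) (Z.+ M) (Z.+ P) (Z.+ N) ⟨
  (Z.+ a Z.+ Z.1ℤ) Z.* Z.+ M Z.+ Z.+ P Z.- ((Z.+ b Z.+ Z.1ℤ) Z.* Z.+ M Z.+ Z.+ N)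
    ≡⟨ cong₂ Z._-_ (numeral-term a M P) (numeral-term b M N) ⟩
  Z.+ ⟦ posExpr ((c , α) ∷ D) ⟧ x Z.- Z.+ ⟦ negExpr ((c , α) ∷ D) ⟧ x ∎
  where
  open ≡-Reasoning
  a = posPart c
  b = negPart c
  M = ⟦ monomial id α ⟧ x
  P = ⟦ posExpr D ⟧ x
  N = ⟦ negExpr D ⟧ x

eval≡0⇔ : ∀ {p} (D : Poly p) x → (eval D x ≡ Z.+ 0) ⇔ (⟦ posExpr D ⟧ x ≡ ⟦ negExpr D ⟧ x)
eval≡0⇔ D x = mk⇔
  (λ D≡0 → ZP.+-injective (ZP.i-j≡0⇒i≡j _ _ (trans (sym (eval-difference D x)) D≡0)))
  (λ P≡N → trans (eval-difference D x) (ZP.i≡j⇒i-j≡0 (cong Z.+_ P≡N)))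

-- Addition by multiplication and successor

AdditionConstraint : ℕ → ℕ → ℕ → Set
AdditionConstraint A B Z = Z * Z * (A * B + 1) + 1 ≡ (A * Z + 1) * (B * Z + 1)

addition-constraint-holds : ∀ A B → AdditionConstraint A B (A + B)
addition-constraint-holds = identity
  where
  identity : ∀ A B → (A + B) * (A + B) * (A * B + 1) + 1 ≡ (A * (A + B) + 1) * (B * (A + B) + 1)
  identity = ℕSolver.solve-∀

addition-constraint-unique : ∀ A B Z → 1 ≤ Z → AdditionConstraint A B Z → Z ≡ A + B
addition-constraint-unique A B Z@(suc _) _ constraint =
  ℕP.*-cancelʳ-≡ Z (A + B) Z (ℕP.suc-injective (ℕP.+-cancelˡ-≡ (A * B * Z * Z) _ _ expanded))
  where
  expand-left : ∀ A B Z → Z * Z * (A * B + 1) + 1 ≡ A * B * Z * Z + (1 + Z * Z)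
  expand-left = ℕSolver.solve-∀
  expand-right : ∀ A B Z → (A * Z + 1) * (B * Z + 1) ≡ A * B * Z * Z + (1 + (A + B) * Z)
  expand-right = ℕSolver.solve-∀
  expanded : A * B * Z * Z + (1 + Z * Z) ≡ A * B * Z * Z + (1 + (A + B) * Z)
  expanded = begin
    A * B * Z * Z + (1 + Z * Z)       ≡⟨ expand-left A B Z ⟨
    Z * Z * (A * B + 1) + 1           ≡⟨ constraint ⟩
    (A * Z + 1) * (B * Z + 1)         ≡⟨ expand-right A B Z ⟩
    A * B * Z * Z + (1 + (A + B) * Z) ∎
    where open ≡-Reasoning

additionValues : ℕ → ℕ → ℕ → List ℕ
additionValues A B Z =
  Z ∷ A * Z ∷ A * Z + 1 ∷ B * Z ∷ B * Z + 1 ∷ (A * Z + 1) * (B * Z + 1) ∷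
  A * B ∷ A * B + 1 ∷ Z * Z ∷ Z * Z * (A * B + 1) ∷ []

additionValues-positive : ∀ {A B Z} → 1 ≤ A → 1 ≤ B → 1 ≤ Z → All (1 ≤_) (additionValues A B Z)
additionValues-positive {A} {B} {Z} A⁺ B⁺ Z⁺ =
  Z⁺ ∷ 1≤m*n A⁺ Z⁺ ∷ 1≤n+1 _ ∷ 1≤m*n B⁺ Z⁺ ∷ 1≤n+1 _ ∷ 1≤m*n (1≤n+1 (A * Z)) (1≤n+1 (B * Z)) ∷
  1≤m*n A⁺ B⁺ ∷ 1≤n+1 _ ∷ 1≤m*n Z⁺ Z⁺ ∷ 1≤m*n (1≤m*n Z⁺ Z⁺) (1≤n+1 (A * B)) ∷ []

-- Compilation into E_n

width : ∀ {p} → Expr p → ℕ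
width (var i)   = 0
width one       = 0
width (mul a b) = width a + (width b + 1)
width (add a b) = width a + (width b + 10)
width (succ a)  = width a + 1

values : ∀ {p} → Expr p → (Fin p → ℕ) → List ℕ
values (var i)   x = []
values one       x = []
values (mul a b) x = values a x ++ (values b x ++ (⟦ a ⟧ x * ⟦ b ⟧ x ∷ []))
values (add a b) x = values a x ++ (values b x ++ additionValues (⟦ a ⟧ x) (⟦ b ⟧ x) (⟦ a ⟧ x + ⟦ b ⟧ x))
values (succ a)  x = values a x ++ (⟦ a ⟧ x + 1 ∷ [])

length-values : ∀ {p} (e : Expr p) x → length (values e x) ≡ width e
length-values (var i)   x = refl
length-values one       x = refl
length-values (mul a b) x = trans (length-++ (values a x))
  (cong₂ _+_ (length-values a x) (trans (length-++ (values b x)) (cong (_+ 1) (length-values b x))))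
length-values (add a b) x = trans (length-++ (values a x))
  (cong₂ _+_ (length-values a x) (trans (length-++ (values b x)) (cong (_+ 10) (length-values b x))))
length-values (succ a)  x = trans (length-++ (values a x)) (cong (_+ 1) (length-values a x))

values-positive : ∀ {p} (e : Expr p) {x} → Positive x → All (1 ≤_) (values e x)
values-positive (var i)   x⁺ = []
values-positive one       x⁺ = []
values-positive (mul a b) x⁺ = ++⁺ (values-positive a x⁺) (++⁺ (values-positive b x⁺)
  (1≤m*n (⟦⟧-positive a x⁺) (⟦⟧-positive b x⁺) ∷ []))
values-positive (add a b) x⁺ = ++⁺ (values-positive a x⁺) (++⁺ (values-positive b x⁺)
  (additionValues-positive (⟦⟧-positive a x⁺) (⟦⟧-positive b x⁺) (⟦⟧-positive (add a b) x⁺)))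
values-positive (succ a) {x} x⁺ = ++⁺ (values-positive a x⁺) (1≤n+1 (⟦ a ⟧ x) ∷ [])

-- Out-of-range positions read as 1, so that positivity of a list transfers to nth.
nth : List ℕ → ℕ → ℕ
nth []       _       = 1
nth (v ∷ vs) zero    = v
nth (v ∷ vs) (suc i) = nth vs i

nth-positive : ∀ {vs} → All (1 ≤_) vs → ∀ i → 1 ≤ nth vs i
nth-positive []         i       = s≤s z≤n
nth-positive (v⁺ ∷ vs⁺) zero    = v⁺
nth-positive (v⁺ ∷ vs⁺) (suc i) = nth-positive vs⁺ i

Solves-++⁺ : ∀ {n} {f : Fin n → ℕ} (S : System n) {T} → Solves f S → Solves f T → Solves f (S ++ T)
Solves-++⁺ []      _         t = t
Solves-++⁺ (e ∷ S) (h , s) t = h , Solves-++⁺ S s t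

Solves-++⁻ : ∀ {n} {f : Fin n → ℕ} (S : System n) {T} → Solves f (S ++ T) → Solves f S × Solves f T
Solves-++⁻ []      st        = tt , st
Solves-++⁻ (e ∷ S) (h , st) = let s , t = Solves-++⁻ S st in (h , s) , t

-- Variables are addressed by natural numbers, translated into Fin N by `address`:
-- the inputs sit at 0, …, p − 1, the constant 1 at p, and e compiled at n occupies
-- n, …, n + width e − 1, listing the subterm values in post-order.
module Compile (p : ℕ) {N : ℕ} (address : ℕ → Fin N) where

  output : Expr p → ℕ → ℕ
  output (var i)   n = toℕ i
  output one       n = p
  output (mul a b) n = n + width a + width b
  output (add a b) n = n + width a + width b
  output (succ a)  n = n + width a

  additionEquations : ℕ → ℕ → ℕ → System N
  additionEquations a b z =
    mulEq (address a) (address z) (address (1 + z)) ∷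
    sucEq (address (1 + z)) (address (2 + z)) ∷
    mulEq (address b) (address z) (address (3 + z)) ∷
    sucEq (address (3 + z)) (address (4 + z)) ∷
    mulEq (address (2 + z)) (address (4 + z)) (address (5 + z)) ∷
    mulEq (address a) (address b) (address (6 + z)) ∷
    sucEq (address (6 + z)) (address (7 + z)) ∷
    mulEq (address z) (address z) (address (8 + z)) ∷
    mulEq (address (8 + z)) (address (7 + z)) (address (9 + z)) ∷
    sucEq (address (9 + z)) (address (5 + z)) ∷ []

  equations : Expr p → ℕ → System N
  equations (var i)   n = []
  equations one       n = []
  equations (mul a b) n = equations a n ++ (equations b (n + width a) ++
    (mulEq (address (output a n)) (address (output b (n + width a))) (address (n + width a + width b)) ∷ []))
  equations (add a b) n = equations a n ++ (equations b (n + width a) ++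
    additionEquations (output a n) (output b (n + width a)) (n + width a + width b))
  equations (succ a)  n = equations a n ++ (sucEq (address (output a n)) (address (n + width a)) ∷ [])

  Stores : (Fin N → ℕ) → ℕ → List ℕ → Set
  Stores f n []       = ⊤
  Stores f n (v ∷ vs) = f (address n) ≡ v × Stores f (suc n) vs

  Stores-++⁺ : ∀ {f n} vs {ws k} → length vs ≡ k → Stores f n vs → Stores f (n + k) ws → Stores f n (vs ++ ws)
  Stores-++⁺ {f} {n} []       {ws} refl _        st = subst (λ t → Stores f t ws) (ℕP.+-identityʳ n) st
  Stores-++⁺ {f} {n} (v ∷ vs) {ws} refl (h , sv) sw =
    h , Stores-++⁺ vs refl sv (subst (λ t → Stores f t ws) (ℕP.+-suc n (length vs)) sw)

  Stores-++⁻ : ∀ {f n} vs {ws k} → length vs ≡ k → Stores f n (vs ++ ws) → Stores f n vs × Stores f (n + k) ws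
  Stores-++⁻ {f} {n} []       {ws} refl st       = tt , subst (λ t → Stores f t ws) (sym (ℕP.+-identityʳ n)) st
  Stores-++⁻ {f} {n} (v ∷ vs) {ws} refl (h , st) =
    let sv , sw = Stores-++⁻ vs refl st
    in  (h , sv) , subst (λ t → Stores f t ws) (sym (ℕP.+-suc n (length vs))) sw

  Stores⇒nth : ∀ {f n} vs i → i < length vs → Stores f n vs → f (address (n + i)) ≡ nth vs i
  Stores⇒nth {f} {n} (v ∷ vs) zero    _        (h , _)  = trans (cong (f ∘ address) (ℕP.+-identityʳ n)) h
  Stores⇒nth {f} {n} (v ∷ vs) (suc i) (s≤s i<) (_ , st) =
    trans (cong (f ∘ address) (ℕP.+-suc n i)) (Stores⇒nth vs i i< st)

  nth⇒Stores : ∀ {f n} vs → (∀ i → i < length vs → f (address (n + i)) ≡ nth vs i) → Stores f n vs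
  nth⇒Stores         []       _   = tt
  nth⇒Stores {f} {n} (v ∷ vs) at =
    trans (cong (f ∘ address) (sym (ℕP.+-identityʳ n))) (at 0 (s≤s z≤n)) ,
    nth⇒Stores vs (λ i i< → trans (cong (f ∘ address) (sym (ℕP.+-suc n i))) (at (suc i) (s≤s i<)))

  Stores-node⁺ : ∀ (a b : Expr p) {x f n vs} → Stores f n (values a x) → Stores f (n + width a) (values b x) →
    Stores f (n + width a + width b) vs → Stores f n (values a x ++ (values b x ++ vs))
  Stores-node⁺ a b {x} stᵃ stᵇ st =
    Stores-++⁺ (values a x) (length-values a x) stᵃ (Stores-++⁺ (values b x) (length-values b x) stᵇ st)

  Stores-node⁻ : ∀ (a b : Expr p) {x f n vs} → Stores f n (values a x ++ (values b x ++ vs)) →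
    Stores f n (values a x) × Stores f (n + width a) (values b x) × Stores f (n + width a + width b) vs
  Stores-node⁻ a b {x} st =
    let stᵃ , st′ = Stores-++⁻ (values a x) (length-values a x) st
        stᵇ , st″ = Stores-++⁻ (values b x) (length-values b x) st′
    in  stᵃ , stᵇ , st″

  Solves-node⁺ : ∀ (a b : Expr p) {f n S} → Solves f (equations a n) → Solves f (equations b (n + width a)) →
    Solves f S → Solves f (equations a n ++ (equations b (n + width a) ++ S))
  Solves-node⁺ a b {n = n} sᵃ sᵇ s = Solves-++⁺ (equations a n) sᵃ (Solves-++⁺ (equations b (n + width a)) sᵇ s)

  Solves-node⁻ : ∀ (a b : Expr p) {f n S} → Solves f (equations a n ++ (equations b (n + width a) ++ S)) →
    Solves f (equations a n) × Solves f (equations b (n + width a)) × Solves f S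
  Solves-node⁻ a b {n = n} s =
    let sᵃ , s′ = Solves-++⁻ (equations a n) s
        sᵇ , s″ = Solves-++⁻ (equations b (n + width a)) s′
    in  sᵃ , sᵇ , s″

module Correctness {p N : ℕ} (address : ℕ → Fin N) (x : Fin p → ℕ) (f : Fin N → ℕ)
  (f-positive : Positive f) (f-input : ∀ i → f (address (toℕ i)) ≡ x i) (f-one : f (address p) ≡ 1) where
  open Compile p address

  additionEquations-sound : ∀ a b z {A B} → f (address a) ≡ A → f (address b) ≡ B →
    Solves f (additionEquations a b z) →
    Stores f z (additionValues A B (f (address z))) × AdditionConstraint A B (f (address z))
  additionEquations-sound a b z refl refl (e₁ , e₂ , e₃ , e₄ , e₅ , e₆ , e₇ , e₈ , e₉ , e₁₀ , _) =
    (refl , v₁ , v₂ , v₃ , v₄ , v₅ , v₆ , v₇ , v₈ , v₉ , tt) ,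
    trans (cong (_+ 1) (sym v₉)) (trans e₁₀ v₅)
    where
    v₁ = sym e₁
    v₂ = trans (sym e₂) (cong (_+ 1) v₁)
    v₃ = sym e₃
    v₄ = trans (sym e₄) (cong (_+ 1) v₃)
    v₅ = trans (sym e₅) (cong₂ _*_ v₂ v₄)
    v₆ = sym e₆
    v₇ = trans (sym e₇) (cong (_+ 1) v₆)
    v₈ = sym e₈
    v₉ = trans (sym e₉) (cong₂ _*_ v₈ v₇)

  additionEquations-complete : ∀ a b z {A B Z} → f (address a) ≡ A → f (address b) ≡ B →
    Stores f z (additionValues A B Z) → AdditionConstraint A B Z → Solves f (additionEquations a b z)
  additionEquations-complete a b z {A} {B} refl refl (v₀ , v₁ , v₂ , v₃ , v₄ , v₅ , v₆ , v₇ , v₈ , v₉ , _) constraint =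
    trans (cong (A *_) v₀) (sym v₁) ,
    trans (cong (_+ 1) v₁) (sym v₂) ,
    trans (cong (B *_) v₀) (sym v₃) ,
    trans (cong (_+ 1) v₃) (sym v₄) ,
    trans (cong₂ _*_ v₂ v₄) (sym v₅) ,
    sym v₆ ,
    trans (cong (_+ 1) v₆) (sym v₇) ,
    trans (cong₂ _*_ v₀ v₀) (sym v₈) ,
    trans (cong₂ _*_ v₈ v₇) (sym v₉) ,
    trans (cong (_+ 1) v₉) (trans constraint (sym v₅)) , tt

  output-value : ∀ e n → Stores f n (values e x) → f (address (output e n)) ≡ ⟦ e ⟧ x
  output-value (var i)   n _  = f-input i
  output-value one       n _  = f-one
  output-value (mul a b) n st = proj₁ (proj₂ (proj₂ (Stores-node⁻ a b st)))
  output-value (add a b) n st = proj₁ (proj₂ (proj₂ (Stores-node⁻ a b st)))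
  output-value (succ a)  n st = proj₁ (proj₂ (Stores-++⁻ (values a x) (length-values a x) st))

  equations-sound : ∀ e n → Solves f (equations e n) → Stores f n (values e x)
  equations-sound (var i)   n _ = tt
  equations-sound one       n _ = tt
  equations-sound (mul a b) n s =
    let sᵃ , sᵇ , (product , _) = Solves-node⁻ a b s
        stᵃ = equations-sound a n sᵃ
        stᵇ = equations-sound b (n + width a) sᵇ
    in  Stores-node⁺ a b stᵃ stᵇ
          (trans (sym product) (cong₂ _*_ (output-value a n stᵃ) (output-value b (n + width a) stᵇ)) , tt)
  equations-sound (add a b) n s =
    let sᵃ , sᵇ , sᶻ = Solves-node⁻ a b s
        stᵃ = equations-sound a n sᵃ
        stᵇ = equations-sound b (n + width a) sᵇ
        z = n + width a + width b
        stᶻ , constraint = additionEquations-sound (output a n) (output b (n + width a)) z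
                             (output-value a n stᵃ) (output-value b (n + width a) stᵇ) sᶻ
        Z≡A+B = addition-constraint-unique (⟦ a ⟧ x) (⟦ b ⟧ x) _ (f-positive (address z)) constraint
    in  Stores-node⁺ a b stᵃ stᵇ (subst (Stores f z ∘ additionValues (⟦ a ⟧ x) (⟦ b ⟧ x)) Z≡A+B stᶻ)
  equations-sound (succ a)  n s =
    let sᵃ , (successor , _) = Solves-++⁻ (equations a n) s
        stᵃ = equations-sound a n sᵃ
    in  Stores-++⁺ (values a x) (length-values a x) stᵃ
          (trans (sym successor) (cong (_+ 1) (output-value a n stᵃ)) , tt)

  equations-complete : ∀ e n → Stores f n (values e x) → Solves f (equations e n)
  equations-complete (var i)   n _  = tt
  equations-complete one       n _  = tt
  equations-complete (mul a b) n st =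
    let stᵃ , stᵇ , (product , _) = Stores-node⁻ a b st
    in  Solves-node⁺ a b (equations-complete a n stᵃ) (equations-complete b (n + width a) stᵇ)
          (trans (cong₂ _*_ (output-value a n stᵃ) (output-value b (n + width a) stᵇ)) (sym product) , tt)
  equations-complete (add a b) n st =
    let stᵃ , stᵇ , stᶻ = Stores-node⁻ a b {x} {f} st
    in  Solves-node⁺ a b (equations-complete a n stᵃ) (equations-complete b (n + width a) stᵇ)
          (additionEquations-complete (output a n) (output b (n + width a)) (n + width a + width b)
            (output-value a n stᵃ) (output-value b (n + width a) stᵇ) stᶻ
            (addition-constraint-holds (⟦ a ⟧ x) (⟦ b ⟧ x)))
  equations-complete (succ a)  n st =
    let stᵃ , (successor , _) = Stores-++⁻ (values a x) (length-values a x) st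
    in  Solves-++⁺ (equations a n) (equations-complete a n stᵃ)
          (trans (cong (_+ 1) (output-value a n stᵃ)) (sym successor) , tt)

-- The system for a polynomial

n*n≡n⇒n≡1 : ∀ {n} → 1 ≤ n → n * n ≡ n → n ≡ 1
n*n≡n⇒n≡1 {n@(suc _)} _ nn≡n = ℕP.*-cancelʳ-≡ n 1 n (trans nn≡n (sym (ℕP.*-identityˡ n)))

clamp : ∀ {N} → Fin N → ℕ → Fin N
clamp {N} default j with j <? N
... | yes j<N = fromℕ< j<N
... | no  _   = default

clamp-toℕ : ∀ {N} (default k : Fin N) → clamp default (toℕ k) ≡ k
clamp-toℕ {N} default k with toℕ k <? N
... | yes k<N = FinP.fromℕ<-toℕ k k<N
... | no  k≮N = ⊥-elim (k≮N (FinP.toℕ<n k))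

⊕-positive : ∀ {p m} {x : Fin p → ℕ} {y : Fin m → ℕ} → Positive x → Positive y → Positive (x ⊕ y)
⊕-positive {p} x⁺ y⁺ i with splitAt p i
... | inj₁ j = x⁺ j
... | inj₂ j = y⁺ j

module Encoding {p : ℕ} (D : Poly p) where
  P = posExpr D
  N = negExpr D
  m = suc (width P + (width N + 1))

  address : ℕ → Fin (p + m)
  address = clamp (p ↑ʳ Data.Fin.zero)

  open Compile p address

  outputP = output P (suc p)
  outputN = output N (suc p + width P)
  top     = suc p + width P + width N

  system : System (p + m)
  system =
    mulEq (address p) (address p) (address p) ∷
    (equations P (suc p) ++ (equations N (suc p + width P) ++
      (sucEq (address outputP) (address top) ∷ sucEq (address outputN) (address top) ∷ [])))

  auxiliaryValues : (Fin p → ℕ) → List ℕ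
  auxiliaryValues x = 1 ∷ (values P x ++ (values N x ++ (⟦ P ⟧ x + 1 ∷ [])))

  length-auxiliaryValues : ∀ x → length (auxiliaryValues x) ≡ m
  length-auxiliaryValues x = cong suc (trans (length-++ (values P x)) (cong₂ _+_ (length-values P x)
     (trans (length-++ (values N x)) (cong (_+ 1) (length-values N x)))))

  ⊕-input : ∀ x (y : Fin m → ℕ) i → (x ⊕ y) (address (toℕ i)) ≡ x i
  ⊕-input x y i = begin
    (x ⊕ y) (address (toℕ i))        ≡⟨ cong ((x ⊕ y) ∘ address) (FinP.toℕ-↑ˡ i m) ⟨
    (x ⊕ y) (address (toℕ (i ↑ˡ m))) ≡⟨ cong (x ⊕ y) (clamp-toℕ _ (i ↑ˡ m)) ⟩
    (x ⊕ y) (i ↑ˡ m)                 ≡⟨ VecFunP.lookup-++ˡ x y i ⟩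
    x i                              ∎
    where open ≡-Reasoning

  ⊕-auxiliary : ∀ x (y : Fin m → ℕ) j → (x ⊕ y) (address (p + toℕ j)) ≡ y j
  ⊕-auxiliary x y j = begin
    (x ⊕ y) (address (p + toℕ j))    ≡⟨ cong ((x ⊕ y) ∘ address) (FinP.toℕ-↑ʳ p j) ⟨
    (x ⊕ y) (address (toℕ (p ↑ʳ j))) ≡⟨ cong (x ⊕ y) (clamp-toℕ _ (p ↑ʳ j)) ⟩
    (x ⊕ y) (p ↑ʳ j)                 ≡⟨ VecFunP.lookup-++ʳ x y j ⟩
    y j                              ∎
    where open ≡-Reasoning

  system-sound : ∀ {x y} → Positive x → Positive y → Solves (x ⊕ y) system →
    ⟦ P ⟧ x ≡ ⟦ N ⟧ x × Stores (x ⊕ y) p (auxiliaryValues x)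
  system-sound {x} {y} x⁺ y⁺ (unit , s) =
    let f⁺ = ⊕-positive x⁺ y⁺
        f-one = n*n≡n⇒n≡1 (f⁺ (address p)) unit
        open Correctness address x (x ⊕ y) f⁺ (⊕-input x y) f-one
        sᴾ , sᴺ , (topᴾ , topᴺ , _) = Solves-node⁻ P N s
        stᴾ = equations-sound P (suc p) sᴾ
        stᴺ = equations-sound N (suc p + width P) sᴺ
        P+1≡top = trans (cong (_+ 1) (sym (output-value P (suc p) stᴾ))) topᴾ
        N+1≡top = trans (cong (_+ 1) (sym (output-value N (suc p + width P) stᴺ))) topᴺ
    in  ℕP.+-cancelʳ-≡ 1 _ _ (trans P+1≡top (sym N+1≡top)) ,
        (f-one , Stores-node⁺ P N stᴾ stᴺ (sym P+1≡top , tt))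

  witness : (Fin p → ℕ) → Fin m → ℕ
  witness x j = nth (auxiliaryValues x) (toℕ j)

  witness-positive : ∀ {x} → Positive x → Positive (witness x)
  witness-positive x⁺ j = nth-positive (s≤s z≤n ∷ ++⁺ (values-positive P x⁺)
                            (++⁺ (values-positive N x⁺) (1≤n+1 _ ∷ []))) (toℕ j)

  witness-stored : ∀ x → Stores (x ⊕ witness x) p (auxiliaryValues x)
  witness-stored x = nth⇒Stores (auxiliaryValues x) at
    where
    at : ∀ i → i < length (auxiliaryValues x) → (x ⊕ witness x) (address (p + i)) ≡ nth (auxiliaryValues x) i
    at i i< = let i<m = subst (i <_) (length-auxiliaryValues x) i< in
      subst (λ t → (x ⊕ witness x) (address (p + t)) ≡ nth (auxiliaryValues x) t) (FinP.toℕ-fromℕ< i<m)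
            (⊕-auxiliary x (witness x) (fromℕ< i<m))

  witness-solves : ∀ {x} → Positive x → ⟦ P ⟧ x ≡ ⟦ N ⟧ x → Solves (x ⊕ witness x) system
  witness-solves {x} x⁺ P≡N =
    let f-one , stored = witness-stored x
        open Correctness address x (x ⊕ witness x) (⊕-positive x⁺ (witness-positive x⁺)) (⊕-input x (witness x)) f-one
        stᴾ , stᴺ , (topP , _) = Stores-node⁻ P N stored
    in  trans (cong₂ _*_ f-one f-one) (sym f-one) ,
        Solves-node⁺ P N (equations-complete P (suc p) stᴾ) (equations-complete N (suc p + width P) stᴺ)
          (trans (cong (_+ 1) (output-value P (suc p) stᴾ)) (sym topP) ,
           trans (cong (_+ 1) (trans (output-value N (suc p + width P) stᴺ) (sym P≡N))) (sym topP) , tt)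

  solution-unique : ∀ {x y} → Positive x → Positive y → Solves (x ⊕ y) system → ∀ j → y j ≡ witness x j
  solution-unique {x} {y} x⁺ y⁺ s j =
    trans (sym (⊕-auxiliary x y j))
      (Stores⇒nth (auxiliaryValues x) (toℕ j)
        (subst (toℕ j <_) (sym (length-auxiliaryValues x)) (FinP.toℕ<n j)) (proj₂ (system-sound x⁺ y⁺ s)))

lemma2 : (p : ℕ) (D : Poly p) → ((i : Fin p) → DegGe1 D i) →
    Σ ℕ λ m → Σ (System (p + m)) λ T →
      (1 ≤ m)
      × ((x : Fin p → ℕ) → Positive x →
           (eval D x ≡ Data.Integer.+ 0) ⇔ (∃ λ (y : Fin m → ℕ) → Positive y × Solves (x ⊕ y) T))
      × ((x : Fin p → ℕ) → Positive x → eval D x ≡ Data.Integer.+ 0 →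
           (∃ λ (y : Fin m → ℕ) → Positive y × Solves (x ⊕ y) T)
           × ((y z : Fin m → ℕ) → Positive y → Solves (x ⊕ y) T →
                Positive z → Solves (x ⊕ z) T → (i : Fin m) → y i ≡ z i))
lemma2 p D _ = m , system , s≤s z≤n ,
  (λ x x⁺ → mk⇔ (extension x⁺) (λ (y , y⁺ , s) → from (eval≡0⇔ D x) (proj₁ (system-sound x⁺ y⁺ s)))) ,
  (λ x x⁺ D≡0 → extension x⁺ D≡0 ,
     λ y z y⁺ sy z⁺ sz i → trans (solution-unique x⁺ y⁺ sy i) (sym (solution-unique x⁺ z⁺ sz i)))
  where
  open Encoding D
  open Equivalence using (to; from)
  extension : ∀ {x} → Positive x → eval D x ≡ Z.+ 0 → ∃ λ (y : Fin m → ℕ) → Positive y × Solves (x ⊕ y) system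
  extension {x} x⁺ D≡0 = witness x , witness-positive x⁺ , witness-solves x⁺ (to (eval≡0⇔ D x) D≡0)
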